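{- Let $H=(V,E)$ be a hypergraph and $e\in E$. Then \[\lambda_e = \max_{e \subseteq S \subseteq V} \Phi(H[S]).\]
   Context: A hypergraph $H=(V,E)$ has a finite vertex set $V$ and a (multi)set $E$ of hyperedges, each a subset of $V$ with at least two vertices. For a partition of $V$ into nonempty parts $V_1,\dots,V_k$, $E[V_1,\dots,V_k]$ denotes the set of hyperedges not contained in any single part. The minimum normalized $k$-cut is $\Phi(H)=\min_{2\le k\le |V|}\ \min_{V_1\cup\dots\cup V_k=V} |E[V_1,\dots,V_k]|/(k-1)$, the inner minimum over partitions of $V$ into $k$ nonempty parts. For $S\subseteq V$, $H[S]$ is the sub-hypergraph on $S$ consisting of the hyperedges contained in $S$. The strength $\lambda_e$ of each hyperedge of $H$ is defined recursively: choose a partition $V_1,\dots,V_k$ attaining $\Phi(H)$; each $e\in E[V_1,\dots,V_k]$ gets $\lambda_e=\Phi(H)$; every other hyperedge is contained in some $V_i$ and gets the strength recursively defined for it inside $H[V_i]$. -}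

module Defs where

open import Data.Nat using (ℕ; zero; suc; _≤_)
open import Data.Integer using (+_)
open import Data.Rational using (ℚ; _/_) renaming (_≤_ to _≤ℚ_)
open import Data.Bool using (Bool; _∧_; not)
open import Data.Fin using (Fin; _≟_)
open import Data.Fin.Properties using (any?)
open import Data.Fin.Subset using (Subset; _∈_; _⊆_; ∣_∣; ⊤)
open import Data.Fin.Subset.Properties using (_∈?_; _⊆?_)
open import Data.Vec using (tabulate)
open import Data.Product using (Σ; ∃; _×_; _,_)
open import Relation.Nullary using (¬_; does; ¬?)
open import Relation.Nullary.Decidable using (_×-dec_)
open import Relation.Binary.PropositionalEquality using (_≡_)

-- The (multi)set of hyperedges is
-- given as an indexed family  E : Fin m → Subset n  (repetitions allowed).
-- A vertex set W : Subset n determines the sub-hypergraph H[W], whose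
-- hyperedges are those E i with E i ⊆ W.

-- A partition of W into k nonempty parts is given by a labelling p : Fin n → Fin k
-- (only its values on W matter) such that each label is used by some vertex of W.
IsPartition : ∀ {n k} → Subset n → (Fin n → Fin k) → Set
IsPartition {n} {k} W p = (c : Fin k) → ∃ λ (v : Fin n) → v ∈ W × p v ≡ c

part : ∀ {n k} → Subset n → (Fin n → Fin k) → Fin k → Subset n
part W p c = tabulate λ v → does (v ∈? W) ∧ does (p v ≟ c)

crosses? : ∀ {n k} → (Fin n → Fin k) → Subset n → Bool
crosses? p e = does (any? λ u → any? λ v → (u ∈? e) ×-dec ((v ∈? e) ×-dec ¬? (p u ≟ p v)))

cutEdges : ∀ {n m k} → (Fin m → Subset n) → Subset n → (Fin n → Fin k) → Subset m
cutEdges E W p = tabulate λ i → does (E i ⊆? W) ∧ crosses? p (E i)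

-- |E[V_1,…,V_k]| / (k-1), for k = 2 + j parts
normCut : ∀ {n m} (j : ℕ) → (Fin m → Subset n) → Subset n → (Fin n → Fin (suc (suc j))) → ℚ
normCut j E W p = (+ ∣ cutEdges E W p ∣) / suc j

-- φ = Φ(H[W]) : φ is attained by some partition of W into k ≥ 2 nonempty parts,
-- and is ≤ the normalized cut of every such partition.
-- (k ≤ |W| is automatic since the parts are nonempty.)
IsPhi : ∀ {n m} → (Fin m → Subset n) → Subset n → ℚ → Set
IsPhi {n} E W φ =
  (∃ λ (j : ℕ) → ∃ λ (p : Fin n → Fin (suc (suc j))) → IsPartition W p × normCut j E W p ≡ φ)
  × ((j : ℕ) (p : Fin n → Fin (suc (suc j))) → IsPartition W p → φ ≤ℚ normCut j E W p)

-- IsStrength E W λ : λ restricted to the hyperedges of H[W] is a strength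
-- assignment of H[W] obtained by the recursive definition (for SOME choice of
-- optimal partitions at each step).
data IsStrength {n m : ℕ} (E : Fin m → Subset n) (λs : Fin m → ℚ) : Subset n → Set where
  noEdges : ∀ {W} → (∀ i → ¬ (E i ⊆ W)) → IsStrength E λs W
  split   : ∀ {W} (j : ℕ) (p : Fin n → Fin (suc (suc j))) →
            IsPartition W p →
            IsPhi E W (normCut j E W p) →
            (∀ i → E i ⊆ W → crosses? p (E i) ≡ Data.Bool.true → λs i ≡ normCut j E W p) →
            (∀ c → IsStrength E λs (part W p c)) →
            IsStrength E λs W

IsMaxPhiOver : ∀ {n m} → (Fin m → Subset n) → Subset n → ℚ → Set
IsMaxPhiOver {n} E e x =
  (∃ λ (S : Subset n) → e ⊆ S × IsPhi E S x)
  × ((S : Subset n) (φ : ℚ) → e ⊆ S → IsPhi E S φ → φ ≤ℚ x)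

module Submission where

-- Induction along the recursive definition of strength, at a set W ⊇ e with optimal partition p.
-- Two exchange arguments drive it, both because a normalised cut of p is the mediant of the
-- normalised cuts of its pieces.  (1) If S ⊆ W meets two parts of p, merging the parts met by S
-- gives a partition of W, so optimality of p forces Φ(H[S]) ≤ Φ(H[W]).  (2) Splitting one part
-- W_c of p further gives a partition of W, so Φ(H[W]) ≤ Φ(H[W_c]).
-- If e crosses p, then λ_e = Φ(H[W]) and (1) bounds every S ⊇ e.  Otherwise e ⊆ W_c for some c:
-- induction handles S ⊆ W_c, and for S leaving W_c, (1) and (2) give Φ(H[S]) ≤ Φ(H[W]) ≤ Φ(H[W_c]) ≤ λ_e.

open import Defs
open import Data.Nat using (ℕ; zero; suc; pred; _+_; _*_; _≤_; _<_; z≤n; s≤s; s≤s⁻¹)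
import Data.Nat.Properties as ℕ
import Data.Integer as ℤ
import Data.Integer.Properties as ℤ
open import Data.Rational using (ℚ; _/_) renaming (_≤_ to _≤ℚ_)
import Data.Rational.Properties as ℚ
open import Data.Rational.Unnormalised using (mkℚᵘ; *≤*)
import Data.Rational.Unnormalised.Properties as ℚᵘ
open import Data.Fin using (Fin; zero; suc; _≟_; join; splitAt; punchIn)
open import Data.Fin.Properties
  using (any?; ¬Fin0; suc-injective; injective⇒≤; join-splitAt; splitAt-join; punchIn-injective; punchInᵢ≢i)
open import Data.Fin.Subset using (Subset; Nonempty; _∉_; inside; outside; _∈_; _⊆_; _∪_; _∩_; ∣_∣; ⊤; ⊥)
open import Data.Fin.Subset.Properties
  using (_∈?_; _⊆?_; nonempty?; ∈⊤; p⊆q⇒∣p∣≤∣q∣; Empty-unique; ∣⊥∣≡0; x∈p∪q⁻; x∈p∪q⁺; x∈p∩q⁻)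
open import Data.Vec using ([]; _∷_; tabulate)
open import Data.Vec.Properties using (lookup⇒[]=; []=⇒lookup; lookup∘tabulate)
open import Data.Product using (∃; _×_; _,_; proj₁; proj₂)
open import Data.Sum using (_⊎_; inj₁; inj₂; [_,_]′)
import Data.Sum as Sum
open import Data.Sum.Properties using (inj₁-injective; inj₂-injective; ≡-dec)
open import Data.Empty using (⊥-elim) renaming (⊥ to Empty)
open import Function using (_∘_; id; const; flip; Injective)
open import Relation.Nullary using (¬_; Dec; yes; no; does; proof; ¬?; contradiction)
open import Relation.Nullary.Reflects using (Reflects; invert)
open import Relation.Nullary.Decidable using (dec-true; _×-dec_; decidable-stable)
open import Relation.Unary using (Pred; Decidable)
open import Relation.Binary.PropositionalEquality
open import Relation.Binary.Definitions using (DecidableEquality)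
open import Level using (0ℓ)

*≤*⇒/≤/ : ∀ a b c d → a * suc d ≤ c * suc b → (ℤ.+ a) / suc b ≤ℚ (ℤ.+ c) / suc d
*≤*⇒/≤/ a b c d h = ℚ.toℚᵘ-cancel-≤
  (ℚᵘ.≤-respˡ-≃ (ℚᵘ.≃-sym (ℚ.toℚᵘ-fromℚᵘ (mkℚᵘ (ℤ.+ a) b)))
  (ℚᵘ.≤-respʳ-≃ (ℚᵘ.≃-sym (ℚ.toℚᵘ-fromℚᵘ (mkℚᵘ (ℤ.+ c) d)))
  (*≤* (subst₂ ℤ._≤_ (ℤ.pos-* a (suc d)) (ℤ.pos-* c (suc b)) (ℤ.+≤+ h)))))

/≤/⇒*≤* : ∀ a b c d → (ℤ.+ a) / suc b ≤ℚ (ℤ.+ c) / suc d → a * suc d ≤ c * suc b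
/≤/⇒*≤* a b c d h with ℚᵘ.≤-respʳ-≃ (ℚ.toℚᵘ-fromℚᵘ (mkℚᵘ (ℤ.+ c) d))
                       (ℚᵘ.≤-respˡ-≃ (ℚ.toℚᵘ-fromℚᵘ (mkℚᵘ (ℤ.+ a) b)) (ℚ.toℚᵘ-mono-≤ h))
... | *≤* k = ℤ.drop‿+≤+ (subst₂ ℤ._≤_ (sym (ℤ.pos-* a (suc d))) (sym (ℤ.pos-* c (suc b))) k)

-- The two halves of: the mediant (x + y) / (b + d) lies between x / b and y / d.
≤-mediant⇒≤-part : ∀ x y b d c t → x * t ≤ c * b → c ≤ x + y → b + d ≤ t → x * d ≤ y * b
≤-mediant⇒≤-part x y b d c t xt≤cb c≤x+y b+d≤t = ℕ.+-cancelˡ-≤ (x * b) (x * d) (y * b) (begin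
  x * b + x * d   ≡⟨ ℕ.*-distribˡ-+ x b d ⟨
  x * (b + d)     ≤⟨ ℕ.*-monoʳ-≤ x b+d≤t ⟩
  x * t           ≤⟨ xt≤cb ⟩
  c * b           ≤⟨ ℕ.*-monoˡ-≤ b c≤x+y ⟩
  (x + y) * b     ≡⟨ ℕ.*-distribʳ-+ b x y ⟩
  x * b + y * b   ∎)
  where open ℕ.≤-Reasoning

mediant-≤⇒part-≤ : ∀ x y a b d t → x + y ≤ a → a * t ≤ y * b → b ≤ d + t → x * b ≤ a * d
mediant-≤⇒part-≤ x y a b d t x+y≤a at≤yb b≤d+t = ℕ.+-cancelʳ-≤ (a * t) (x * b) (a * d) (begin
  x * b + a * t   ≤⟨ ℕ.+-monoʳ-≤ (x * b) at≤yb ⟩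
  x * b + y * b   ≡⟨ ℕ.*-distribʳ-+ b x y ⟨
  (x + y) * b     ≤⟨ ℕ.*-monoˡ-≤ b x+y≤a ⟩
  a * b           ≤⟨ ℕ.*-monoʳ-≤ a b≤d+t ⟩
  a * (d + t)     ≡⟨ ℕ.*-distribˡ-+ a d t ⟩
  a * d + a * t   ∎)
  where open ℕ.≤-Reasoning

∣p∪q∣+∣p∩q∣≡∣p∣+∣q∣ : ∀ {n} (p q : Subset n) → ∣ p ∪ q ∣ + ∣ p ∩ q ∣ ≡ ∣ p ∣ + ∣ q ∣
∣p∪q∣+∣p∩q∣≡∣p∣+∣q∣ []            []            = refl
∣p∪q∣+∣p∩q∣≡∣p∣+∣q∣ (inside  ∷ p) (inside  ∷ q) = cong suc (begin
  ∣ p ∪ q ∣ + suc ∣ p ∩ q ∣  ≡⟨ ℕ.+-suc ∣ p ∪ q ∣ ∣ p ∩ q ∣ ⟩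
  suc (∣ p ∪ q ∣ + ∣ p ∩ q ∣) ≡⟨ cong suc (∣p∪q∣+∣p∩q∣≡∣p∣+∣q∣ p q) ⟩
  suc (∣ p ∣ + ∣ q ∣)         ≡⟨ ℕ.+-suc ∣ p ∣ ∣ q ∣ ⟨
  ∣ p ∣ + suc ∣ q ∣           ∎)
  where open ≡-Reasoning
∣p∪q∣+∣p∩q∣≡∣p∣+∣q∣ (inside  ∷ p) (outside ∷ q) = cong suc (∣p∪q∣+∣p∩q∣≡∣p∣+∣q∣ p q)
∣p∪q∣+∣p∩q∣≡∣p∣+∣q∣ (outside ∷ p) (inside  ∷ q) =
  trans (cong suc (∣p∪q∣+∣p∩q∣≡∣p∣+∣q∣ p q)) (sym (ℕ.+-suc ∣ p ∣ ∣ q ∣))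
∣p∪q∣+∣p∩q∣≡∣p∣+∣q∣ (outside ∷ p) (outside ∷ q) = ∣p∪q∣+∣p∩q∣≡∣p∣+∣q∣ p q

⊆∪⇒∣p∣≤∣q∣+∣r∣ : ∀ {n} (p q r : Subset n) → p ⊆ q ∪ r → ∣ p ∣ ≤ ∣ q ∣ + ∣ r ∣
⊆∪⇒∣p∣≤∣q∣+∣r∣ p q r p⊆q∪r = begin
  ∣ p ∣                      ≤⟨ p⊆q⇒∣p∣≤∣q∣ p⊆q∪r ⟩
  ∣ q ∪ r ∣                  ≤⟨ ℕ.m≤m+n ∣ q ∪ r ∣ ∣ q ∩ r ∣ ⟩
  ∣ q ∪ r ∣ + ∣ q ∩ r ∣      ≡⟨ ∣p∪q∣+∣p∩q∣≡∣p∣+∣q∣ q r ⟩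
  ∣ q ∣ + ∣ r ∣              ∎
  where open ℕ.≤-Reasoning

disjoint⇒∣p∣+∣q∣≤∣r∣ : ∀ {n} (p q r : Subset n) → p ⊆ r → q ⊆ r →
                       (∀ {i} → i ∈ p → i ∈ q → Empty) → ∣ p ∣ + ∣ q ∣ ≤ ∣ r ∣
disjoint⇒∣p∣+∣q∣≤∣r∣ {n} p q r p⊆r q⊆r disjoint = begin
  ∣ p ∣ + ∣ q ∣              ≡⟨ ∣p∪q∣+∣p∩q∣≡∣p∣+∣q∣ p q ⟨
  ∣ p ∪ q ∣ + ∣ p ∩ q ∣      ≡⟨ cong (λ s → ∣ p ∪ q ∣ + ∣ s ∣) p∩q≡⊥ ⟩
  ∣ p ∪ q ∣ + ∣ ⊥ {n} ∣       ≡⟨ cong (∣ p ∪ q ∣ +_) (∣⊥∣≡0 n) ⟩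
  ∣ p ∪ q ∣ + 0              ≡⟨ ℕ.+-identityʳ _ ⟩
  ∣ p ∪ q ∣                  ≤⟨ p⊆q⇒∣p∣≤∣q∣ (Sum.[ p⊆r , q⊆r ] ∘ x∈p∪q⁻ p q) ⟩
  ∣ r ∣                      ∎
  where
    open ℕ.≤-Reasoning
    p∩q≡⊥ : p ∩ q ≡ ⊥
    p∩q≡⊥ = Empty-unique (λ (i , i∈p∩q) → let i∈p , i∈q = x∈p∩q⁻ p q i∈p∩q in disjoint i∈p i∈q)

splitAt-injective : ∀ m {n} → Injective _≡_ _≡_ (splitAt m {n})
splitAt-injective m {n} {x} {y} eq = begin
  x                       ≡⟨ join-splitAt m n x ⟨
  join m n (splitAt m x)  ≡⟨ cong (join m n) eq ⟩
  join m n (splitAt m y)  ≡⟨ join-splitAt m n y ⟩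
  y                       ∎
  where open ≡-Reasoning

injective⇒≤+ : ∀ {k a b} (F : Fin k → Fin a ⊎ Fin b) → Injective _≡_ _≡_ F → k ≤ a + b
injective⇒≤+ {a = a} {b} F F-inj = injective⇒≤ {f = join a b ∘ F} (λ {x} {y} eq →
  F-inj (trans (sym (splitAt-join a b (F x))) (trans (cong (splitAt a) eq) (splitAt-join a b (F y)))))

-- z, which g avoids, accounts for the extra element in suc k.
module _ {k a b} {P : Pred (Fin k) 0ℓ} (P? : Decidable P)
         (f : ∀ {y} → P y → Fin a) (g : Fin k → Fin b) (z : Fin b)
         (f-injective : ∀ {x y} (px : P x) (py : P y) → f px ≡ f py → x ≡ y)
         (g-injective : ∀ {x y} → ¬ P x → ¬ P y → g x ≡ g y → x ≡ y)
         (g≢z : ∀ {y} → ¬ P y → g y ≢ z) where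

  private
    classify : ∀ y → Dec (P y) → Fin a ⊎ Fin b
    classify y (yes py) = inj₁ (f py)
    classify y (no ¬py) = inj₂ (g y)

    classify-injective : ∀ x y (dx : Dec (P x)) (dy : Dec (P y)) → classify x dx ≡ classify y dy → x ≡ y
    classify-injective x y (yes px) (yes py) eq = f-injective px py (inj₁-injective eq)
    classify-injective x y (no ¬px) (no ¬py) eq = g-injective ¬px ¬py (inj₂-injective eq)

    classify≢z : ∀ y (dy : Dec (P y)) → classify y dy ≢ inj₂ z
    classify≢z y (no ¬py) eq = g≢z ¬py (inj₂-injective eq)

    F : Fin (suc k) → Fin a ⊎ Fin b
    F zero    = inj₂ z
    F (suc y) = classify y (P? y)

    F-injective : Injective _≡_ _≡_ F
    F-injective {zero}  {zero}  _  = refl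
    F-injective {zero}  {suc y} eq = contradiction (sym eq) (classify≢z y (P? y))
    F-injective {suc x} {zero}  eq = contradiction eq (classify≢z x (P? x))
    F-injective {suc x} {suc y} eq = cong suc (classify-injective x y (P? x) (P? y) eq)

  suc≤+-byCases : suc k ≤ a + b
  suc≤+-byCases = injective⇒≤+ F F-injective

∈-tabulate⁺ : ∀ {n} {P : Pred (Fin n) 0ℓ} (P? : Decidable P) {i} → P i → i ∈ tabulate (does ∘ P?)
∈-tabulate⁺ P? {i} Pi = lookup⇒[]= i _ (trans (lookup∘tabulate _ i) (dec-true (P? i) Pi))

∈-tabulate⁻ : ∀ {n} {P : Pred (Fin n) 0ℓ} (P? : Decidable P) {i} → i ∈ tabulate (does ∘ P?) → P i
∈-tabulate⁻ P? {i} i∈ = invert (subst (Reflects _) (trans (sym (lookup∘tabulate _ i)) ([]=⇒lookup i∈)) (proof (P? i)))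

module _ {n k : ℕ} {W : Subset n} (p : Fin n → Fin k) {c : Fin k} where

  ∈-part⁺ : ∀ {v} → v ∈ W → p v ≡ c → v ∈ part W p c
  ∈-part⁺ v∈W pv≡c = ∈-tabulate⁺ (λ v → (v ∈? W) ×-dec (p v ≟ c)) (v∈W , pv≡c)

  ∈-part⁻ : ∀ {v} → v ∈ part W p c → v ∈ W × p v ≡ c
  ∈-part⁻ = ∈-tabulate⁻ (λ v → (v ∈? W) ×-dec (p v ≟ c))

⊆-part⊎leaves : ∀ {n k} {S W : Subset n} (p : Fin n → Fin k) (c : Fin k) → S ⊆ W →
                S ⊆ part W p c ⊎ ∃ λ v → v ∈ S × p v ≢ c
⊆-part⊎leaves {S = S} p c S⊆W with any? (λ v → (v ∈? S) ×-dec ¬? (p v ≟ c))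
... | yes leaves = inj₂ leaves
... | no  ∄v     = inj₁ λ {x} x∈S →
  ∈-part⁺ p (S⊆W x∈S) (decidable-stable (p x ≟ c) (λ px≢c → ∄v (x , x∈S , px≢c)))

Crosses : ∀ {n k} → (Fin n → Fin k) → Subset n → Set
Crosses p e = ∃ λ u → ∃ λ v → u ∈ e × v ∈ e × p u ≢ p v

-- does (crosses-dec p e) is definitionally crosses? p e.
crosses-dec : ∀ {n k} (p : Fin n → Fin k) (e : Subset n) → Dec (Crosses p e)
crosses-dec p e = any? λ u → any? λ v → (u ∈? e) ×-dec ((v ∈? e) ×-dec ¬? (p u ≟ p v))

¬Crosses⇒≡ : ∀ {n k} {p : Fin n → Fin k} {e : Subset n} → ¬ Crosses p e → ∀ {u v} → u ∈ e → v ∈ e → p u ≡ p v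
¬Crosses⇒≡ {p = p} ¬cross {u} {v} u∈e v∈e with p u ≟ p v
... | yes pu≡pv = pu≡pv
... | no  pu≢pv = contradiction (u , v , u∈e , v∈e , pu≢pv) ¬cross

module _ {n m : ℕ} (E : Fin m → Subset n) where

  ∈-cutEdges⁺ : ∀ {k W} {p : Fin n → Fin k} {i} → E i ⊆ W → Crosses p (E i) → i ∈ cutEdges E W p
  ∈-cutEdges⁺ {W = W} {p} Ei⊆W cross = ∈-tabulate⁺ (λ i → (E i ⊆? W) ×-dec crosses-dec p (E i)) (Ei⊆W , cross)

  ∈-cutEdges⁻ : ∀ {k W} {p : Fin n → Fin k} {i} → i ∈ cutEdges E W p → E i ⊆ W × Crosses p (E i)
  ∈-cutEdges⁻ {W = W} {p} = ∈-tabulate⁻ (λ i → (E i ⊆? W) ×-dec crosses-dec p (E i))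

Refines : ∀ {n} {A B : Set} → Subset n → (Fin n → A) → (Fin n → B) → Set
Refines W p q = ∀ {u v} → u ∈ W → v ∈ W → p u ≡ p v → q u ≡ q v

record InducedPartition {n} {A : Set} (W : Subset n) (g : Fin n → A) (t : ℕ) : Set where
  field
    label       : Fin n → Fin t
    isPartition : IsPartition W label
    reflects    : Refines W label g
    respects    : Refines W g label

  size-≥ : ∀ {a} (F : Fin a → Fin n) → (∀ x → F x ∈ W) → Injective _≡_ _≡_ (g ∘ F) → a ≤ t
  size-≥ F F∈W g∘F-injective = injective⇒≤ {f = label ∘ F} (λ eq → g∘F-injective (reflects (F∈W _) (F∈W _) eq))

module _ {A : Set} (_≟A_ : DecidableEquality A) where

  private
    normalise⊤ : ∀ {n} (g : Fin n → A) → ∃ (InducedPartition ⊤ g)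
    normalise⊤ {zero} g = 0 , record
      { label = λ () ; isPartition = λ ()
      ; reflects = λ {u} → ⊥-elim (¬Fin0 u) ; respects = λ {u} → ⊥-elim (¬Fin0 u) }
    normalise⊤ {suc n} g with normalise⊤ (g ∘ suc) | any? (λ w → g (suc w) ≟A g zero)
    ... | t , N | yes (w , gw≡g0) = t , record
          { label = label ∘ rep ; isPartition = λ c → let v , _ , ℓv≡c = isPartition c in suc v , ∈⊤ , ℓv≡c
          ; reflects = λ {u} {v} _ _ eq → trans (sym (g∘rep u)) (trans (reflects ∈⊤ ∈⊤ eq) (g∘rep v))
          ; respects = λ {u} {v} _ _ eq → respects ∈⊤ ∈⊤ (trans (g∘rep u) (trans eq (sym (g∘rep v)))) }
      where
        open InducedPartition N
        rep : Fin (suc n) → Fin n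
        rep zero    = w
        rep (suc v) = v
        g∘rep : ∀ v → g (suc (rep v)) ≡ g v
        g∘rep zero    = gw≡g0
        g∘rep (suc v) = refl
    ... | t , N | no g0-new = suc t , record
          { label = label′ ; isPartition = isPartition′ ; reflects = reflects′ ; respects = respects′ }
      where
        open InducedPartition N
        label′ : Fin (suc n) → Fin (suc t)
        label′ zero    = zero
        label′ (suc v) = suc (label v)
        isPartition′ : IsPartition ⊤ label′
        isPartition′ zero    = zero , ∈⊤ , refl
        isPartition′ (suc c) = let v , _ , ℓv≡c = isPartition c in suc v , ∈⊤ , cong suc ℓv≡c
        reflects′ : Refines ⊤ label′ g
        reflects′ {zero}  {zero}  _ _ _  = refl
        reflects′ {suc u} {suc v} _ _ eq = reflects ∈⊤ ∈⊤ (suc-injective eq)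
        respects′ : Refines ⊤ g label′
        respects′ {zero}  {zero}  _ _ _  = refl
        respects′ {zero}  {suc v} _ _ eq = contradiction (v , sym eq) g0-new
        respects′ {suc u} {zero}  _ _ eq = contradiction (u , eq) g0-new
        respects′ {suc u} {suc v} _ _ eq = cong suc (respects ∈⊤ ∈⊤ eq)

    retract : ∀ {n} (W : Subset n) {w₀} → w₀ ∈ W → Fin n → Fin n
    retract W {w₀} _ v with v ∈? W
    ... | yes _ = v
    ... | no  _ = w₀

    retract-∈ : ∀ {n} (W : Subset n) {w₀} (w₀∈W : w₀ ∈ W) v → retract W w₀∈W v ∈ W
    retract-∈ W w₀∈W v with v ∈? W
    ... | yes v∈W = v∈W
    ... | no  _   = w₀∈W

    retract-id : ∀ {n} (W : Subset n) {w₀} (w₀∈W : w₀ ∈ W) {v} → v ∈ W → retract W w₀∈W v ≡ v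
    retract-id W w₀∈W {v} v∈W with v ∈? W
    ... | yes _    = refl
    ... | no  v∉W = contradiction v∈W v∉W

  normalise : ∀ {n} (W : Subset n) (g : Fin n → A) {w₀} → w₀ ∈ W → ∃ (InducedPartition W g)
  normalise W g w₀∈W with normalise⊤ (g ∘ retract W w₀∈W)
  ... | t , N = t , record
        { label = label
        ; isPartition = λ c → let v , _ , ℓv≡c = isPartition c in
                        ρ v , retract-∈ W w₀∈W v , trans (respects ∈⊤ ∈⊤ (cong g (ρ-idem v))) ℓv≡c
        ; reflects = λ u∈W v∈W eq → subst₂ (λ x y → g x ≡ g y) (ρ-id u∈W) (ρ-id v∈W) (reflects ∈⊤ ∈⊤ eq)
        ; respects = λ u∈W v∈W eq → respects ∈⊤ ∈⊤ (subst₂ (λ x y → g x ≡ g y) (sym (ρ-id u∈W)) (sym (ρ-id v∈W)) eq) }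
    where
      open InducedPartition N
      ρ = retract W w₀∈W
      ρ-id = retract-id W w₀∈W
      ρ-idem : ∀ v → ρ (ρ v) ≡ ρ v
      ρ-idem v = ρ-id (retract-∈ W w₀∈W v)

  normalise₂ : ∀ {n} (W : Subset n) (g : Fin n → A) {u v} → u ∈ W → v ∈ W → g u ≢ g v →
               ∃ λ j → InducedPartition W g (suc (suc j))
  normalise₂ {n} W g {u} {v} u∈W v∈W gu≢gv =
    let _ , N = normalise W g u∈W in atLeastTwo N (InducedPartition.size-≥ N uv uv∈W uv-injective)
    where
      atLeastTwo : ∀ {t} → InducedPartition W g t → 2 ≤ t → ∃ λ j → InducedPartition W g (suc (suc j))
      atLeastTwo N (s≤s (s≤s _)) = _ , N
      uv : Fin 2 → Fin n
      uv zero       = u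
      uv (suc zero) = v
      uv∈W : ∀ x → uv x ∈ W
      uv∈W zero       = u∈W
      uv∈W (suc zero) = v∈W
      uv-injective : Injective _≡_ _≡_ (g ∘ uv)
      uv-injective {zero}     {zero}     _  = refl
      uv-injective {zero}     {suc zero} eq = contradiction eq gu≢gv
      uv-injective {suc zero} {zero}     eq = contradiction (sym eq) gu≢gv
      uv-injective {suc zero} {suc zero} _  = refl

module _ {n k : ℕ} (S : Subset n) (p : Fin n → Fin k) where

  Meets : Pred (Fin k) 0ℓ
  Meets y = ∃ λ w → w ∈ S × p w ≡ y

  meets? : Decidable Meets
  meets? y = any? λ w → (w ∈? S) ×-dec (p w ≟ y)

  collapseMet : Fin k → Fin k → Fin k
  collapseMet c y with meets? y
  ... | yes _ = c
  ... | no  _ = y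

  collapseMet-met : ∀ {c y} → Meets y → collapseMet c y ≡ c
  collapseMet-met {y = y} my with meets? y
  ... | yes _   = refl
  ... | no  ¬my = contradiction my ¬my

  collapseMet-¬met : ∀ {c y} → ¬ Meets y → collapseMet c y ≡ y
  collapseMet-¬met {y = y} ¬my with meets? y
  ... | yes my = contradiction my ¬my
  ... | no  _  = refl

  -- The blocks met by S are told apart by Q, the others by M, and the merged block of M is one more.
  collapseMet-count : ∀ {W : Subset n} {u kS tM} → IsPartition W p → S ⊆ W → u ∈ S →
                      InducedPartition S p kS → InducedPartition W (collapseMet (p u) ∘ p) tM → suc k ≤ kS + tM
  collapseMet-count {W} {u} p-part S⊆W u∈S Q M =
    suc≤+-byCases meets? (label Q ∘ proj₁) (label M ∘ rep) (label M u) Q-injective M-rep-injective M-rep≢M-u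
    where
      open InducedPartition
      collapse = collapseMet (p u)
      rep : Fin k → Fin n
      rep y = proj₁ (p-part y)
      rep∈W : ∀ y → rep y ∈ W
      rep∈W y = proj₁ (proj₂ (p-part y))
      collapse-rep : ∀ {y} → ¬ Meets y → collapse (p (rep y)) ≡ y
      collapse-rep {y} ¬my = trans (cong collapse (proj₂ (proj₂ (p-part y)))) (collapseMet-¬met ¬my)

      Q-injective : ∀ {x y} (mx : Meets x) (my : Meets y) → label Q (proj₁ mx) ≡ label Q (proj₁ my) → x ≡ y
      Q-injective (w , w∈S , pw≡x) (w′ , w′∈S , pw′≡y) eq = trans (sym pw≡x) (trans (reflects Q w∈S w′∈S eq) pw′≡y)

      M-rep-injective : ∀ {x y} → ¬ Meets x → ¬ Meets y → label M (rep x) ≡ label M (rep y) → x ≡ y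
      M-rep-injective {x} {y} ¬mx ¬my eq =
        trans (sym (collapse-rep ¬mx)) (trans (reflects M (rep∈W x) (rep∈W y) eq) (collapse-rep ¬my))

      M-rep≢M-u : ∀ {y} → ¬ Meets y → label M (rep y) ≢ label M u
      M-rep≢M-u {y} ¬my eq = ¬my (u , u∈S , trans (sym (collapseMet-met (u , u∈S , refl)))
        (trans (sym (reflects M (rep∈W y) (S⊆W u∈S) eq)) (collapse-rep ¬my)))

module _ {n k k′ : ℕ} (p : Fin n → Fin k) (c : Fin k) (q : Fin n → Fin k′) where

  refineBy : Fin n → Fin k ⊎ Fin k′
  refineBy v with p v ≟ c
  ... | yes _ = inj₂ (q v)
  ... | no  _ = inj₁ (p v)

  refineBy-inside : ∀ {v} → p v ≡ c → refineBy v ≡ inj₂ (q v)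
  refineBy-inside {v} pv≡c with p v ≟ c
  ... | yes _    = refl
  ... | no  pv≢c = contradiction pv≡c pv≢c

  refineBy-outside : ∀ {v} → p v ≢ c → refineBy v ≡ inj₁ (p v)
  refineBy-outside {v} pv≢c with p v ≟ c
  ... | yes pv≡c = contradiction pv≡c pv≢c
  ... | no  _    = refl

  refineBy-coarse : ∀ {u v} → p u ≡ p v → (p u ≡ c → q u ≡ q v) → refineBy u ≡ refineBy v
  refineBy-coarse {u} {v} pu≡pv qu≡qv = by-cases (p u ≟ c)
    where
      by-cases : Dec (p u ≡ c) → refineBy u ≡ refineBy v
      by-cases (yes pu≡c) = trans (refineBy-inside pu≡c)
        (trans (cong inj₂ (qu≡qv pu≡c)) (sym (refineBy-inside (trans (sym pu≡pv) pu≡c))))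
      by-cases (no pu≢c) = trans (refineBy-outside pu≢c)
        (trans (cong inj₁ pu≡pv) (sym (refineBy-outside (pu≢c ∘ trans pu≡pv))))

-- One vertex for each block of p other than c, and one for each block of q, are told apart by refineBy p c q.
refineBy-count : ∀ {n k k′} {W : Subset n} {p : Fin n → Fin (suc k)} {c} {q : Fin n → Fin k′} {t} →
                 IsPartition W p → IsPartition (part W p c) q → InducedPartition W (refineBy p c q) t → k + k′ ≤ t
refineBy-count {n} {k} {k′} {W} {p} {c} {q} p-part q-part R =
  size-≥ R (vertex ∘ splitAt k) (vertex∈W ∘ splitAt k) refineBy-vertex-injective
  where
    open InducedPartition
    vertex : Fin k ⊎ Fin k′ → Fin n
    vertex (inj₁ y) = proj₁ (p-part (punchIn c y))
    vertex (inj₂ z) = proj₁ (q-part z)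
    vertex∈W : ∀ x → vertex x ∈ W
    vertex∈W (inj₁ y) = proj₁ (proj₂ (p-part (punchIn c y)))
    vertex∈W (inj₂ z) = proj₁ (∈-part⁻ p (proj₁ (proj₂ (q-part z))))

    refineBy-vertex : ∀ x → refineBy p c q (vertex x) ≡ Sum.map (punchIn c) id x
    refineBy-vertex (inj₁ y) = trans (refineBy-outside p c q (punchInᵢ≢i c y ∘ trans (sym pv≡y))) (cong inj₁ pv≡y)
      where pv≡y = proj₂ (proj₂ (p-part (punchIn c y)))
    refineBy-vertex (inj₂ z) = trans (refineBy-inside p c q (proj₂ (∈-part⁻ p (proj₁ (proj₂ (q-part z))))))
                                     (cong inj₂ (proj₂ (proj₂ (q-part z))))

    punchIn⊎id-injective : Injective _≡_ _≡_ (Sum.map (punchIn c) (id {A = Fin k′}))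
    punchIn⊎id-injective {inj₁ x} {inj₁ y} eq = cong inj₁ (punchIn-injective c x y (inj₁-injective eq))
    punchIn⊎id-injective {inj₂ x} {inj₂ y} eq = cong inj₂ (inj₂-injective eq)

    refineBy-vertex-injective : Injective _≡_ _≡_ (refineBy p c q ∘ vertex ∘ splitAt k)
    refineBy-vertex-injective {x} {y} eq = splitAt-injective k (punchIn⊎id-injective
      (trans (sym (refineBy-vertex (splitAt k x))) (trans eq (refineBy-vertex (splitAt k y)))))

module _ {n m : ℕ} (E : Fin m → Subset n) where

  cutEdges-⊆ : ∀ {k k′} {S W : Subset n} {p : Fin n → Fin k} {q : Fin n → Fin k′} →
               S ⊆ W → Refines S p q → cutEdges E S q ⊆ cutEdges E W p
  cutEdges-⊆ S⊆W p⊑q i∈cut with ∈-cutEdges⁻ E i∈cut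
  ... | Ei⊆S , u , v , u∈Ei , v∈Ei , qu≢qv =
    ∈-cutEdges⁺ E (S⊆W ∘ Ei⊆S) (u , v , u∈Ei , v∈Ei , qu≢qv ∘ p⊑q (Ei⊆S u∈Ei) (Ei⊆S v∈Ei))

  cutEdges-disjoint : ∀ {k k′} {S W : Subset n} {q : Fin n → Fin k} {h : Fin n → Fin k′} →
                      (∀ {u v} → u ∈ S → v ∈ S → h u ≡ h v) →
                      ∀ {i} → i ∈ cutEdges E S q → i ∈ cutEdges E W h → Empty
  cutEdges-disjoint h-const i∈cutS i∈cutW with ∈-cutEdges⁻ E i∈cutS | ∈-cutEdges⁻ E i∈cutW
  ... | Ei⊆S , _ | _ , u , v , u∈Ei , v∈Ei , hu≢hv = hu≢hv (h-const (Ei⊆S u∈Ei) (Ei⊆S v∈Ei))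

  cutEdges-refineBy : ∀ {k k′ kh} {W : Subset n} (p : Fin n → Fin k) (c : Fin k) (q : Fin n → Fin k′)
                      {h : Fin n → Fin kh} → Refines W (refineBy p c q) h → cutEdges E W h ⊆ cutEdges E W p ∪ cutEdges E (part W p c) q
  cutEdges-refineBy {W = W} p c q refineBy⊑h {i} i∈cut with ∈-cutEdges⁻ E i∈cut
  ... | Ei⊆W , u , v , u∈Ei , v∈Ei , hu≢hv = by-cases (crosses-dec p (E i))
    where
      by-cases : Dec (Crosses p (E i)) → i ∈ cutEdges E W p ∪ cutEdges E (part W p c) q
      by-cases (yes p-cross) = x∈p∪q⁺ (inj₁ (∈-cutEdges⁺ E Ei⊆W p-cross))
      by-cases (no ¬p-cross) = x∈p∪q⁺ (inj₂ (∈-cutEdges⁺ E Ei⊆part (u , v , u∈Ei , v∈Ei , separated ∘ const)))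
        where
          separated : (p u ≡ c → q u ≡ q v) → Empty
          separated = hu≢hv ∘ refineBy⊑h (Ei⊆W u∈Ei) (Ei⊆W v∈Ei)
                    ∘ refineBy-coarse p c q (¬Crosses⇒≡ ¬p-cross u∈Ei v∈Ei)
          pu≡c : p u ≡ c
          pu≡c = decidable-stable (p u ≟ c) (λ pu≢c → separated (flip contradiction pu≢c))
          Ei⊆part : E i ⊆ part W p c
          Ei⊆part x∈Ei = ∈-part⁺ p (Ei⊆W x∈Ei) (trans (¬Crosses⇒≡ ¬p-cross x∈Ei u∈Ei) pu≡c)

  -- Stated for normCut (and applied with explicit implicit arguments) so that Agda never unfolds _/_, which is very slow.
  *≤*⇒normCut≤ : ∀ {W W′ : Subset n} {j j′} (p : Fin n → Fin (suc (suc j))) (q : Fin n → Fin (suc (suc j′))) →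
                 ∣ cutEdges E W p ∣ * suc j′ ≤ ∣ cutEdges E W′ q ∣ * suc j → normCut j E W p ≤ℚ normCut j′ E W′ q
  *≤*⇒normCut≤ {W} {W′} {j} {j′} p q = *≤*⇒/≤/ (∣ cutEdges E W p ∣) j (∣ cutEdges E W′ q ∣) j′

  normCut≤⇒*≤* : ∀ {W W′ : Subset n} {j j′} (p : Fin n → Fin (suc (suc j))) (q : Fin n → Fin (suc (suc j′))) →
                 normCut j E W p ≤ℚ normCut j′ E W′ q → ∣ cutEdges E W p ∣ * suc j′ ≤ ∣ cutEdges E W′ q ∣ * suc j
  normCut≤⇒*≤* {W} {W′} {j} {j′} p q = /≤/⇒*≤* (∣ cutEdges E W p ∣) j (∣ cutEdges E W′ q ∣) j′

  optimal-cut-bound : ∀ {W j} {p : Fin n → Fin (suc (suc j))} → IsPhi E W (normCut j E W p) →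
                      ∀ {t} (h : Fin n → Fin t) → IsPartition W h →
                      ∣ cutEdges E W p ∣ * pred t ≤ ∣ cutEdges E W h ∣ * suc j
  optimal-cut-bound {W} {j} {p} _ {zero} _ _ = ℕ.≤-trans (ℕ.≤-reflexive (ℕ.*-zeroʳ ∣ cutEdges E W p ∣)) z≤n
  optimal-cut-bound {W} {j} {p} _ {suc zero} _ _ = ℕ.≤-trans (ℕ.≤-reflexive (ℕ.*-zeroʳ ∣ cutEdges E W p ∣)) z≤n
  optimal-cut-bound {W} {j} {p} (_ , minimal) {suc (suc t)} h h-part =
    normCut≤⇒*≤* {W} {W} {j} {t} p h (minimal t h h-part)

  -- Merge the parts of p that S meets into one: by optimality of p this cannot lower the normalised cut.
  optimal-≥-Φ-ofSubset : ∀ {W S : Subset n} {j} {p : Fin n → Fin (suc (suc j))} →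
                         IsPartition W p → IsPhi E W (normCut j E W p) → S ⊆ W →
                         ∀ {u v} → u ∈ S → v ∈ S → p u ≢ p v →
                         ∀ {φ} → IsPhi E S φ → φ ≤ℚ normCut j E W p
  optimal-≥-Φ-ofSubset {W} {S} {j} {p} p-part p-optimal S⊆W {u} u∈S v∈S pu≢pv (_ , φ-minimal) =
    let jS , Q = normalise₂ _≟_ S p u∈S v∈S pu≢pv in
    ℚ.≤-trans (φ-minimal jS (label Q) (isPartition Q))
              (*≤*⇒normCut≤ {S} {W} {_} {j} (label Q) p
                       (cut-ratio-bound Q (proj₂ (normalise _≟_ W (collapse ∘ p) (S⊆W u∈S)))))
    where
      open InducedPartition
      collapse = collapseMet S p (p u)

      cut-ratio-bound : ∀ {jS tM} (Q : InducedPartition S p (suc (suc jS))) → InducedPartition W (collapse ∘ p) tM →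
                        ∣ cutEdges E S (label Q) ∣ * suc j ≤ ∣ cutEdges E W p ∣ * suc jS
      cut-ratio-bound {jS} {tM} Q M =
        mediant-≤⇒part-≤ cS cM a (suc j) (suc jS) (pred tM) cS+cM≤a
          (optimal-cut-bound p-optimal (label M) (isPartition M)) parts-count
        where
          a  = ∣ cutEdges E W p ∣
          cS = ∣ cutEdges E S (label Q) ∣
          cM = ∣ cutEdges E W (label M) ∣

          M-constant-on-S : ∀ {x y} → x ∈ S → y ∈ S → label M x ≡ label M y
          M-constant-on-S x∈S y∈S = respects M (S⊆W x∈S) (S⊆W y∈S)
            (trans (collapseMet-met S p (_ , x∈S , refl)) (sym (collapseMet-met S p (_ , y∈S , refl))))

          cS+cM≤a : cS + cM ≤ a
          cS+cM≤a = disjoint⇒∣p∣+∣q∣≤∣r∣ (cutEdges E S (label Q)) (cutEdges E W (label M)) (cutEdges E W p)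
            (cutEdges-⊆ S⊆W (respects Q))
            (cutEdges-⊆ id (λ x∈W y∈W px≡py → respects M x∈W y∈W (cong collapse px≡py)))
            (cutEdges-disjoint M-constant-on-S)

          parts-count : suc j ≤ suc jS + pred tM
          parts-count = ≤+pred (suc j) (suc jS) tM (s≤s⁻¹ (collapseMet-count S p p-part S⊆W u∈S Q M))
            where
              ≤+pred : ∀ b d t → suc b ≤ d + t → b ≤ d + pred t
              ≤+pred b d zero    sb≤d+0 = ℕ.≤-trans (ℕ.n≤1+n b) sb≤d+0
              ≤+pred b d (suc t) sb≤d+st = s≤s⁻¹ (subst (suc b ≤_) (ℕ.+-suc d t) sb≤d+st)

  -- Split the part c of p further by q: by optimality of p this cannot lower the normalised cut.
  optimal-≤-partitionOfPart : ∀ {W : Subset n} {j j′} {p : Fin n → Fin (suc (suc j))} →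
                              IsPartition W p → IsPhi E W (normCut j E W p) →
                              ∀ c {q : Fin n → Fin (suc (suc j′))} → IsPartition (part W p c) q →
                              normCut j E W p ≤ℚ normCut j′ E (part W p c) q
  optimal-≤-partitionOfPart {W} {j} {j′} {p} p-part p-optimal c {q} q-part =
    *≤*⇒normCut≤ {W} {part W p c} {j} {j′} p q
      (cut-ratio-bound (proj₂ (normalise (≡-dec _≟_ _≟_) W (refineBy p c q) (proj₁ (proj₂ (p-part c))))))
    where
      open InducedPartition
      a  = ∣ cutEdges E W p ∣
      cQ = ∣ cutEdges E (part W p c) q ∣

      cut-ratio-bound : ∀ {tR} → InducedPartition W (refineBy p c q) tR → a * suc j′ ≤ cQ * suc j
      cut-ratio-bound {tR} R =
        ≤-mediant⇒≤-part a cQ (suc j) (suc j′) cR (pred tR)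
          (optimal-cut-bound p-optimal (label R) (isPartition R)) cR≤a+cQ parts-count
        where
          cR = ∣ cutEdges E W (label R) ∣
          cR≤a+cQ : cR ≤ a + cQ
          cR≤a+cQ = ⊆∪⇒∣p∣≤∣q∣+∣r∣ (cutEdges E W (label R)) (cutEdges E W p) (cutEdges E (part W p c) q)
            (cutEdges-refineBy p c q (respects R))
          parts-count : suc j + suc j′ ≤ pred tR
          parts-count = subst (_≤ pred tR) (ℕ.+-suc j (suc j′)) (ℕ.pred-mono-≤ (refineBy-count p-part q-part R))

0<∣p∣⇒Nonempty : ∀ {n} (p : Subset n) → 0 < ∣ p ∣ → Nonempty p
0<∣p∣⇒Nonempty {n} p 0<∣p∣ with nonempty? p
... | yes p≢∅ = p≢∅
... | no  p≡∅ = contradiction (trans (cong ∣_∣ (Empty-unique p≡∅)) (∣⊥∣≡0 n)) (ℕ.>⇒≢ 0<∣p∣)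

module _ {n m : ℕ} (E : Fin m → Subset n) (λs : Fin m → ℚ) where

  strength⇒Φ : ∀ {W i} → IsStrength E λs W → E i ⊆ W →
               ∃ λ j → ∃ λ (p : Fin n → Fin (suc (suc j))) → IsPartition W p × IsPhi E W (normCut j E W p)
  strength⇒Φ {i = i} (noEdges none)          Ei⊆W = ⊥-elim (none i Ei⊆W)
  strength⇒Φ         (split j p p-part φ _ _) _    = j , p , p-part , φ

  IsMaxPhiWithin : Subset n → Subset n → ℚ → Set
  IsMaxPhiWithin W e x = (∃ λ S → e ⊆ S × S ⊆ W × IsPhi E S x) × (∀ S {φ} → e ⊆ S → S ⊆ W → IsPhi E S φ → φ ≤ℚ x)

  module _ (e : Fin m) {u₀ : Fin n} (u₀∈e : u₀ ∈ E e) where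

    strength-isMaxPhi : ∀ {W} → IsStrength E λs W → E e ⊆ W → IsMaxPhiWithin W (E e) (λs e)
    strength-isMaxPhi (noEdges none) e⊆W = ⊥-elim (none e e⊆W)
    strength-isMaxPhi {W} (split j p p-part p-optimal λ-cut parts) e⊆W = by-cases (crosses-dec p (E e))
      where
        by-cases : Dec (Crosses p (E e)) → IsMaxPhiWithin W (E e) (λs e)
        by-cases (yes e-crosses@(u , v , u∈e , v∈e , pu≢pv)) =
          (W , e⊆W , id , subst (IsPhi E W) (sym λe≡Φ) p-optimal) ,
          λ S e⊆S S⊆W φS → subst (_ ≤ℚ_) (sym λe≡Φ)
                             (optimal-≥-Φ-ofSubset E p-part p-optimal S⊆W (e⊆S u∈e) (e⊆S v∈e) pu≢pv φS)
          where
            λe≡Φ : λs e ≡ normCut j E W p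
            λe≡Φ = λ-cut e e⊆W (dec-true (crosses-dec p (E e)) e-crosses)
        by-cases (no ¬e-crosses) = attained (proj₁ IH) , bound
          where
            c = p u₀
            e⊆part : E e ⊆ part W p c
            e⊆part x∈e = ∈-part⁺ p (e⊆W x∈e) (¬Crosses⇒≡ ¬e-crosses x∈e u₀∈e)
            IH = strength-isMaxPhi (parts c) e⊆part
            attained : (∃ λ S → E e ⊆ S × S ⊆ part W p c × IsPhi E S (λs e)) →
                       ∃ λ S → E e ⊆ S × S ⊆ W × IsPhi E S (λs e)
            attained (S , e⊆S , S⊆part , φS) = S , e⊆S , proj₁ ∘ ∈-part⁻ p ∘ S⊆part , φS
            Φ≤λe : normCut j E W p ≤ℚ λs e
            Φ≤λe = let _ , q , q-part , q-optimal = strength⇒Φ (parts c) e⊆part in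
              ℚ.≤-trans (optimal-≤-partitionOfPart E p-part p-optimal c q-part)
                        (proj₂ IH (part W p c) e⊆part id q-optimal)
            bound : ∀ S {φ} → E e ⊆ S → S ⊆ W → IsPhi E S φ → φ ≤ℚ λs e
            bound S e⊆S S⊆W φS = [ (λ (S⊆part : S ⊆ part W p c) → proj₂ IH S e⊆S S⊆part φS)
                                 , (λ (v , v∈S , pv≢c) → ℚ.≤-trans
                                      (optimal-≥-Φ-ofSubset E p-part p-optimal S⊆W (e⊆S u₀∈e) v∈S (pv≢c ∘ sym) φS) Φ≤λe)
                                 ]′ (⊆-part⊎leaves p c S⊆W)

mainTheorem7 : ∀ {n m : ℕ} (E : Fin m → Subset n) → (∀ i → 2 ≤ ∣ E i ∣) →
               (λs : Fin m → ℚ) → IsStrength E λs ⊤ →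
               (e : Fin m) → IsMaxPhiOver E (E e) (λs e)
mainTheorem7 E ∣E∣≥2 λs strength e =
  let u₀ , u₀∈e = 0<∣p∣⇒Nonempty (E e) (ℕ.<-≤-trans (s≤s z≤n) (∣E∣≥2 e))
      (S , e⊆S , _ , φS) , bounded = strength-isMaxPhi E λs e u₀∈e strength (λ _ → ∈⊤)
  in (S , e⊆S , φS) , λ S φ e⊆S → bounded S e⊆S (λ _ → ∈⊤)
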